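{- Let $F_m(x)=\sum_{n\ge0}b(n,m)x^n$ for $m\ge0$. Then $F_0(x)=\frac{1}{1-x}$ and, for every integer $m\ge1$, $$F_m(x)=\frac{1}{ -x+F_{m-1}(-x)}.$$
   Context: For a positive integer $m$, $B(m)=(b_{ij})_{1\le i,j\le m}$ is the $m\times m$ matrix with $b_{ij}=1$ if $i+j\le m+1$ and $0$ otherwise. For a square matrix $A$, $s(A)$ is the sum of all its entries. Define $b(n,m)$ for $n,m\ge0$ by $b(n,m)=1$ if $n=0$ or $m=0$, and $b(n,m)=s\big(B(m+1)^{n-1}\big)$ if $n,m\ge1$. The identities are of formal power series (equivalently rational functions) in $x$. -}

module Defs where

open import Data.Nat as ℕ using (ℕ; zero; suc; _<ᵇ_)
open import Data.Bool using (if_then_else_)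
open import Data.Fin using (Fin; toℕ) renaming (zero to fzero; suc to fsuc)
open import Relation.Binary.PropositionalEquality using (_≡_)
open import Data.Integer as ℤ using (ℤ; +_; -_)

sumFin : (n : ℕ) → (Fin n → ℕ) → ℕ
sumFin zero    f = 0
sumFin (suc n) f = f fzero ℕ.+ sumFin n (λ i → f (fsuc i))

Mat : ℕ → Set
Mat m = Fin m → Fin m → ℕ

_·ᴹ_ : {m : ℕ} → Mat m → Mat m → Mat m
_·ᴹ_ {m} A C i j = sumFin m (λ k → A i k ℕ.* C k j)

idᴹ : (m : ℕ) → Mat m
idᴹ m i j = if toℕ i ℕ.≡ᵇ toℕ j then 1 else 0

_^ᴹ_ : {m : ℕ} → Mat m → ℕ → Mat m
_^ᴹ_ {m} A zero    = idᴹ m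
_^ᴹ_ {m} A (suc k) = A ·ᴹ (A ^ᴹ k)

s : {m : ℕ} → Mat m → ℕ
s {m} A = sumFin m (λ i → sumFin m (λ j → A i j))

-- B(m): b_ij = 1 iff i + j ≤ m + 1 (1-indexed); with 0-indexed
-- i' = i - 1, j' = j - 1 this is i' + j' < m.
B : (m : ℕ) → Mat m
B m i j = if (toℕ i ℕ.+ toℕ j) <ᵇ m then 1 else 0

b : ℕ → ℕ → ℕ
b zero    m       = 1
b (suc n) zero    = 1
b (suc n) (suc m) = s (B (suc (suc m)) ^ᴹ n)

FPS : Set
FPS = ℕ → ℤ

sumTo : ℕ → (ℕ → ℤ) → ℤ
sumTo zero    f = f 0
sumTo (suc n) f = sumTo n f ℤ.+ f (suc n)

_⊛_ : FPS → FPS → FPS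
(f ⊛ g) n = sumTo n (λ k → f k ℤ.* g (n ℕ.∸ k))

_⊕_ : FPS → FPS → FPS
(f ⊕ g) n = f n ℤ.+ g n

⊖_ : FPS → FPS
(⊖ f) n = - f n

𝟙 : FPS
𝟙 zero    = + 1
𝟙 (suc n) = + 0

𝕩 : FPS
𝕩 1 = + 1
𝕩 _ = + 0

-- substitution x ↦ -x : coefficients multiplied by (-1)^n
negArg : FPS → FPS
negArg f n = (- (+ 1)) ℤ.^ n ℤ.* f n

F : ℕ → FPS
F m n = + b n m

_≐_ : FPS → FPS → Set
f ≐ g = (n : ℕ) → f n ≡ g n

-- Let G_0 = 1 + x and G_(m+1) = x + F_m.  Substituting x ↦ -x in the theorem for F_m gives
-- G_m F_m(-x) = 1, so the theorem for F_(m+1) follows, after multiplying by F_m(-x), from the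
-- recurrence F_(m+1) = G_m + x G_m F_(m+1); induction on m does the rest, the base case being the
-- same computation with G = 1 (F_0 = 1 + x F_0).  The recurrence is combinatorial: row and column 0
-- of B(m+2) are all ones, and deleting them leaves B(m) bordered by a zero row and column.  So the
-- sum of row i+1 of B(m+2)^n is that of row i of B(m)^n plus a convolution of the row-0 sums
-- c_k = b(k, m+1) with row sums of powers of B(m), and summing over all rows turns this into the
-- coefficient identity b(n+1, m+1) = [x^(n+1)] (G_m + x G_m F_(m+1)).
module Submission where

open import Defs
open import Data.Nat as ℕ using (ℕ; zero; suc; _∸_; _≤_; _<_; z≤n)
import Data.Nat.Properties as ℕP
open import Data.Integer using (ℤ)
import Data.Integer.Properties as ℤP
open import Data.Fin using (Fin; toℕ) renaming (zero to fzero; suc to fsuc)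
open import Data.Product using (_×_; _,_)
open import Function using (_∘_)
open import Relation.Binary.PropositionalEquality
open import Algebra.Properties.Semiring.Sum ℕP.+-*-semiring
  using (sum; sum-syntax; sum-cong-≗; sum-init-last; sum-replicate-zero; ∑-distrib-+; ∑-comm; *-distribˡ-sum; *-distribʳ-sum)

module BRowSums where

  open import Data.Nat using (_+_; _*_; _<ᵇ_)
  open import Data.Bool using (true; false; if_then_else_; T)
  open import Data.Fin.Properties using (toℕ<n; toℕ-inject₁; toℕ-fromℕ)
  open import Relation.Nullary using (contradiction)
  open import Algebra.Properties.CommutativeSemigroup ℕP.+-commutativeSemigroup using (x∙yz≈y∙xz)
  open ≡-Reasoning

  sumFin≡sum : ∀ n (f : Fin n → ℕ) → sumFin n f ≡ sum f
  sumFin≡sum zero    f = refl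
  sumFin≡sum (suc n) f = cong (f fzero +_) (sumFin≡sum n (f ∘ fsuc))

  sum-toℕ-init-last : ∀ n (f : ℕ → ℕ) → ∑[ i < suc n ] f (toℕ i) ≡ ∑[ i < n ] f (toℕ i) + f n
  sum-toℕ-init-last n f = trans (sum-init-last {n} (f ∘ toℕ))
    (cong₂ _+_ (sum-cong-≗ {n} (cong f ∘ toℕ-inject₁)) (cong f (toℕ-fromℕ n)))

  sum-zero : ∀ n {f : Fin n → ℕ} → (∀ i → f i ≡ 0) → sum f ≡ 0
  sum-zero n f≗0 = trans (sum-cong-≗ f≗0) (sum-replicate-zero n)

  sum-idᴹ : ∀ m (i : Fin m) → sum (idᴹ m i) ≡ 1
  sum-idᴹ (suc m) fzero    = cong suc (sum-zero m λ _ → refl)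
  sum-idᴹ (suc m) (fsuc i) = sum-idᴹ m i

  sum-^ᴹ-suc : ∀ {m} (A : Mat m) n (i : Fin m) →
               sum ((A ^ᴹ suc n) i) ≡ ∑[ k < m ] (A i k * sum ((A ^ᴹ n) k))
  sum-^ᴹ-suc {m} A n i = begin
    ∑[ j < m ] sumFin m (λ k → A i k * (A ^ᴹ n) k j)  ≡⟨ sum-cong-≗ {m} (λ j → sumFin≡sum m _) ⟩
    ∑[ j < m ] ∑[ k < m ] (A i k * (A ^ᴹ n) k j)      ≡⟨ ∑-comm {m} {m} _ ⟩
    ∑[ k < m ] ∑[ j < m ] (A i k * (A ^ᴹ n) k j)      ≡⟨ sum-cong-≗ {m} (λ k → sym (*-distribˡ-sum {m} (A i k) _)) ⟩
    ∑[ k < m ] (A i k * sum ((A ^ᴹ n) k))             ∎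

  ind : ℕ → ℕ → ℕ
  ind t a = if a <ᵇ t then 1 else 0

  ind-< : ∀ {t a} → a < t → ind t a ≡ 1
  ind-< {t} {a} a<t with a <ᵇ t | ℕP.<⇒<ᵇ a<t
  ... | true | _ = refl

  ind-≥ : ∀ {t a} → t ≤ a → ind t a ≡ 0
  ind-≥ {t} {a} t≤a with a <ᵇ t in eq
  ... | false = refl
  ... | true  = contradiction (ℕP.<ᵇ⇒< a t (subst T (sym eq) _)) (ℕP.≤⇒≯ t≤a)

  -- rowSumB t n i is the sum of row i (0-based) of B(t)^n; rows i ≥ t of B t are zero.
  rowSumB : ℕ → ℕ → ℕ → ℕ
  rowSumB t zero    i = 1
  rowSumB t (suc n) i = ∑[ j < t ] (ind t (i + toℕ j) * rowSumB t n (toℕ j))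

  sum-B^ᴹ : ∀ t n (i : Fin t) → sum ((B t ^ᴹ n) i) ≡ rowSumB t n (toℕ i)
  sum-B^ᴹ t zero    i = sum-idᴹ t i
  sum-B^ᴹ t (suc n) i = trans (sum-^ᴹ-suc (B t) n i)
    (sum-cong-≗ {t} (λ k → cong (B t i k *_) (sum-B^ᴹ t n k)))

  s-B^ᴹ : ∀ t n → s (B t ^ᴹ n) ≡ ∑[ i < t ] rowSumB t n (toℕ i)
  s-B^ᴹ t n = trans (sumFin≡sum t _)
    (sum-cong-≗ {t} (λ i → trans (sumFin≡sum t _) (sum-B^ᴹ t n i)))

  rowSumB-≥ : ∀ {t i} n → t ≤ i → rowSumB t (suc n) i ≡ 0
  rowSumB-≥ {t} {i} n t≤i = sum-zero t λ j →
    cong (_* rowSumB t n (toℕ j)) (ind-≥ (ℕP.≤-trans t≤i (ℕP.m≤m+n i (toℕ j))))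

  rowSumB-one : ∀ n → rowSumB 1 n 0 ≡ 1
  rowSumB-one zero    = refl
  rowSumB-one (suc n) = trans (ℕP.+-identityʳ _) (trans (ℕP.+-identityʳ _) (rowSumB-one n))

  b-suc : ∀ n m → b (suc n) m ≡ ∑[ i < suc m ] rowSumB (suc m) n (toℕ i)
  b-suc n zero    = sym (trans (ℕP.+-identityʳ _) (rowSumB-one n))
  b-suc n (suc m) = s-B^ᴹ (suc (suc m)) n

  -- c is the series F (m+1) and p the series invNegF m (see F-suc-coeff and invNegF-coeff).
  module Recurrence (m : ℕ) where

    c : ℕ → ℕ
    c n = rowSumB (suc (suc m)) n 0

    q : ℕ → ℕ
    q n = ∑[ i < suc m ] rowSumB m n (toℕ i)

    p : ℕ → ℕ
    p zero    = 1
    p (suc n) = q n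

    -- Paths counted in row i+1 of B(m+2)^n that visit index 0, split at their first visit.
    W : ℕ → ℕ → ℕ
    W n i = ∑[ k < n ] (rowSumB m (toℕ k) i * c (n ∸ suc (toℕ k)))

    c-suc-sum : ∀ n → c (suc n) ≡ ∑[ i < suc (suc m) ] rowSumB (suc (suc m)) n (toℕ i)
    c-suc-sum n = sum-cong-≗ {suc (suc m)} λ i →
      trans (cong (_* rowSumB (suc (suc m)) n (toℕ i)) (ind-< (toℕ<n i))) (ℕP.*-identityˡ _)

    -- Row i+1 of B(m+2) has a 1 in column 0, entry (i, j) of B(m) in column j+1, and 0 in column m+1.
    rowSumB-suc-suc : ∀ n i → i < suc m →
      rowSumB (suc (suc m)) (suc n) (suc i)
        ≡ c n + ∑[ j < m ] (ind m (i + toℕ j) * rowSumB (suc (suc m)) n (suc (toℕ j)))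
    rowSumB-suc-suc n i i<1+m = cong₂ _+_ column0 (begin
      ∑[ j < suc m ] (ind (suc m) (i + suc (toℕ j)) * R (suc (toℕ j)))
        ≡⟨ sum-toℕ-init-last m (λ j → ind (suc m) (i + suc j) * R (suc j)) ⟩
      ∑[ j < m ] (ind (suc m) (i + suc (toℕ j)) * R (suc (toℕ j))) + ind (suc m) (i + suc m) * R (suc m)
        ≡⟨ cong₂ _+_ (sum-cong-≗ {m} λ j → cong (λ a → ind (suc m) a * R (suc (toℕ j))) (ℕP.+-suc i (toℕ j)))
                     (cong (_* R (suc m)) (ind-≥ (ℕP.m≤n+m (suc m) i))) ⟩
      ∑[ j < m ] (ind m (i + toℕ j) * R (suc (toℕ j))) + 0
        ≡⟨ ℕP.+-identityʳ _ ⟩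
      ∑[ j < m ] (ind m (i + toℕ j) * R (suc (toℕ j))) ∎)
      where
      R = rowSumB (suc (suc m)) n
      column0 : ind (suc m) (i + 0) * R 0 ≡ c n
      column0 = trans (cong (_* R 0) (ind-< (subst (_< suc m) (sym (ℕP.+-identityʳ i)) i<1+m)))
                    (ℕP.*-identityˡ (R 0))

    W-suc : ∀ n i → W (suc n) i ≡ c n + ∑[ j < m ] (ind m (i + toℕ j) * W n (toℕ j))
    W-suc n i = begin
      1 * c n + ∑[ k < n ] (∑[ j < m ] (ind m (i + toℕ j) * R k j) * c' k)
        ≡⟨ cong₂ _+_ (ℕP.*-identityˡ (c n)) (sum-cong-≗ {n} λ k → *-distribʳ-sum {m} (c' k) _) ⟩
      c n + ∑[ k < n ] ∑[ j < m ] (ind m (i + toℕ j) * R k j * c' k)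
        ≡⟨ cong (c n +_) (∑-comm {n} {m} _) ⟩
      c n + ∑[ j < m ] ∑[ k < n ] (ind m (i + toℕ j) * R k j * c' k)
        ≡⟨ cong (c n +_) (sum-cong-≗ {m} λ j → trans (sum-cong-≗ {n} λ k → ℕP.*-assoc (ind m (i + toℕ j)) _ _)
                                                    (sym (*-distribˡ-sum {n} (ind m (i + toℕ j)) _))) ⟩
      c n + ∑[ j < m ] (ind m (i + toℕ j) * W n (toℕ j)) ∎
      where
      R : Fin n → Fin m → ℕ
      R k j = rowSumB m (toℕ k) (toℕ j)
      c' : Fin n → ℕ
      c' k = c (n ∸ suc (toℕ k))

    rowSumB-shift : ∀ n i → i < suc m → rowSumB (suc (suc m)) n (suc i) ≡ rowSumB m n i + W n i
    rowSumB-shift zero    i _     = refl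
    rowSumB-shift (suc n) i i<1+m = begin
      rowSumB (suc (suc m)) (suc n) (suc i)
        ≡⟨ rowSumB-suc-suc n i i<1+m ⟩
      c n + ∑[ j < m ] (ind m (i + toℕ j) * rowSumB (suc (suc m)) n (suc (toℕ j)))
        ≡⟨ cong (c n +_) (sum-cong-≗ {m} λ j → cong (ind m (i + toℕ j) *_)
                           (rowSumB-shift n (toℕ j) (ℕP.m<n⇒m<1+n (toℕ<n j)))) ⟩
      c n + ∑[ j < m ] (ind m (i + toℕ j) * (rowSumB m n (toℕ j) + W n (toℕ j)))
        ≡⟨ cong (c n +_) (trans (sum-cong-≗ {m} λ j → ℕP.*-distribˡ-+ (ind m (i + toℕ j)) _ _)
                                (∑-distrib-+ {m} _ _)) ⟩
      c n + (rowSumB m (suc n) i + ∑[ j < m ] (ind m (i + toℕ j) * W n (toℕ j)))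
        ≡⟨ x∙yz≈y∙xz (c n) (rowSumB m (suc n) i) _ ⟩
      rowSumB m (suc n) i + (c n + ∑[ j < m ] (ind m (i + toℕ j) * W n (toℕ j)))
        ≡⟨ cong (rowSumB m (suc n) i +_) (sym (W-suc n i)) ⟩
      rowSumB m (suc n) i + W (suc n) i ∎

    sum-W : ∀ n → ∑[ i < suc m ] W n (toℕ i) ≡ ∑[ k < n ] (q (toℕ k) * c (n ∸ suc (toℕ k)))
    sum-W n = trans (∑-comm {suc m} {n} λ i k → rowSumB m (toℕ k) (toℕ i) * c (n ∸ suc (toℕ k)))
      (sum-cong-≗ {n} λ k → sym (*-distribʳ-sum {suc m} (c (n ∸ suc (toℕ k)))
                                                     (λ i → rowSumB m (toℕ k) (toℕ i))))

    c-suc : ∀ n → c (suc n) ≡ p (suc n) + ∑[ k < suc n ] (p (toℕ k) * c (n ∸ toℕ k))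
    c-suc n = begin
      c (suc n)
        ≡⟨ c-suc-sum n ⟩
      c n + ∑[ i < suc m ] rowSumB (suc (suc m)) n (suc (toℕ i))
        ≡⟨ cong (c n +_) (sum-cong-≗ {suc m} λ i → rowSumB-shift n (toℕ i) (toℕ<n i)) ⟩
      c n + ∑[ i < suc m ] (rowSumB m n (toℕ i) + W n (toℕ i))
        ≡⟨ cong (c n +_) (trans (∑-distrib-+ {suc m} (λ i → rowSumB m n (toℕ i)) (λ i → W n (toℕ i)))
                                (cong (q n +_) (sum-W n))) ⟩
      c n + (q n + ∑[ k < n ] (q (toℕ k) * c (n ∸ suc (toℕ k))))
        ≡⟨ x∙yz≈y∙xz (c n) (q n) _ ⟩
      q n + (c n + ∑[ k < n ] (q (toℕ k) * c (n ∸ suc (toℕ k))))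
        ≡⟨ cong (λ a → q n + (a + ∑[ k < n ] (q (toℕ k) * c (n ∸ suc (toℕ k)))))
                (sym (ℕP.*-identityˡ (c n))) ⟩
      p (suc n) + ∑[ k < suc n ] (p (toℕ k) * c (n ∸ toℕ k)) ∎

open BRowSums using (rowSumB; rowSumB-≥; b-suc; sum-toℕ-init-last; module Recurrence)
open import Data.Integer using (+_; -_; _+_; _*_; _^_; 0ℤ; 1ℤ; -1ℤ)
open import Data.Integer.Tactic.RingSolver using (solve-∀)
open import Algebra.Properties.CommutativeSemigroup ℤP.+-commutativeSemigroup using (interchange)
import Relation.Binary.Reasoning.Setoid
open import Relation.Binary.Bundles using (Setoid)

module ≐-Reasoning = Relation.Binary.Reasoning.Setoid (ℕ →-setoid ℤ)
open Setoid (ℕ →-setoid ℤ) using () renaming (sym to ≐-sym; trans to ≐-trans)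

tail : FPS → FPS
tail f n = f (suc n)

sumTo-cong≤ : ∀ n {f g : ℕ → ℤ} → (∀ k → k ≤ n → f k ≡ g k) → sumTo n f ≡ sumTo n g
sumTo-cong≤ zero    f≡g = f≡g 0 z≤n
sumTo-cong≤ (suc n) f≡g =
  cong₂ _+_ (sumTo-cong≤ n λ k k≤n → f≡g k (ℕP.m≤n⇒m≤1+n k≤n)) (f≡g (suc n) ℕP.≤-refl)

sumTo-cong : ∀ n {f g : ℕ → ℤ} → (∀ k → f k ≡ g k) → sumTo n f ≡ sumTo n g
sumTo-cong n f≡g = sumTo-cong≤ n λ k _ → f≡g k

sumTo-suc : ∀ n (f : ℕ → ℤ) → sumTo (suc n) f ≡ f 0 + sumTo n (f ∘ suc)
sumTo-suc zero    f = refl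
sumTo-suc (suc n) f = trans (cong (_+ f (suc (suc n))) (sumTo-suc n f))
                            (ℤP.+-assoc (f 0) (sumTo n (f ∘ suc)) (f (suc (suc n))))

sumTo-distrib-+ : ∀ n (f g : ℕ → ℤ) → sumTo n (λ k → f k + g k) ≡ sumTo n f + sumTo n g
sumTo-distrib-+ zero    f g = refl
sumTo-distrib-+ (suc n) f g = trans (cong (_+ (f (suc n) + g (suc n))) (sumTo-distrib-+ n f g))
                                    (interchange (sumTo n f) (sumTo n g) (f (suc n)) (g (suc n)))

sumTo-*ˡ : ∀ n a (f : ℕ → ℤ) → sumTo n (λ k → a * f k) ≡ a * sumTo n f
sumTo-*ˡ zero    a f = refl
sumTo-*ˡ (suc n) a f = trans (cong (_+ a * f (suc n)) (sumTo-*ˡ n a f))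
                             (sym (ℤP.*-distribˡ-+ a (sumTo n f) (f (suc n))))

sumTo-neg : ∀ n (f : ℕ → ℤ) → sumTo n (λ k → - f k) ≡ - sumTo n f
sumTo-neg n f = begin
  sumTo n (λ k → - f k)       ≡⟨ sumTo-cong n (λ k → sym (ℤP.-1*i≡-i (f k))) ⟩
  sumTo n (λ k → -1ℤ * f k)   ≡⟨ sumTo-*ˡ n -1ℤ f ⟩
  -1ℤ * sumTo n f             ≡⟨ ℤP.-1*i≡-i (sumTo n f) ⟩
  - sumTo n f                 ∎
  where open ≡-Reasoning

sumTo-zero : ∀ n → sumTo n (λ _ → 0ℤ) ≡ 0ℤ
sumTo-zero zero    = refl
sumTo-zero (suc n) = cong (_+ 0ℤ) (sumTo-zero n)

⊛-cong : ∀ {f f′ g g′} → f ≐ f′ → g ≐ g′ → (f ⊛ g) ≐ (f′ ⊛ g′)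
⊛-cong f≐f′ g≐g′ n = sumTo-cong n λ k → cong₂ _*_ (f≐f′ k) (g≐g′ (n ∸ k))

⊛-congˡ : ∀ f {g g′} → g ≐ g′ → (f ⊛ g) ≐ (f ⊛ g′)
⊛-congˡ f = ⊛-cong {f = f} λ _ → refl

⊛-congʳ : ∀ {f f′} g → f ≐ f′ → (f ⊛ g) ≐ (f′ ⊛ g)
⊛-congʳ g f≐f′ = ⊛-cong {g = g} f≐f′ λ _ → refl

⊛-suc : ∀ f g n → (f ⊛ g) (suc n) ≡ f 0 * g (suc n) + (tail f ⊛ g) n
⊛-suc f g n = sumTo-suc n _

⊛-sucʳ : ∀ f g n → (f ⊛ g) (suc n) ≡ (f ⊛ tail g) n + f (suc n) * g 0
⊛-sucʳ f g n = cong₂ _+_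
  (sumTo-cong≤ n λ k k≤n → cong (λ i → f k * g i) (ℕP.+-∸-assoc 1 k≤n))
  (cong (λ i → f (suc n) * g i) (ℕP.n∸n≡0 n))

⊛-comm : ∀ f g → (f ⊛ g) ≐ (g ⊛ f)
⊛-comm f g zero    = ℤP.*-comm (f 0) (g 0)
⊛-comm f g (suc n) = begin
  (f ⊛ g) (suc n)                 ≡⟨ ⊛-suc f g n ⟩
  f 0 * g (suc n) + (tail f ⊛ g) n ≡⟨ cong₂ _+_ (ℤP.*-comm (f 0) (g (suc n))) (⊛-comm (tail f) g n) ⟩
  g (suc n) * f 0 + (g ⊛ tail f) n ≡⟨ ℤP.+-comm (g (suc n) * f 0) _ ⟩
  (g ⊛ tail f) n + g (suc n) * f 0 ≡⟨ ⊛-sucʳ g f n ⟨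
  (g ⊛ f) (suc n)                 ∎
  where open ≡-Reasoning

⊛-distribˡ : ∀ f g h → (f ⊛ (g ⊕ h)) ≐ ((f ⊛ g) ⊕ (f ⊛ h))
⊛-distribˡ f g h n = trans (sumTo-cong n λ k → ℤP.*-distribˡ-+ (f k) (g (n ∸ k)) (h (n ∸ k)))
                           (sumTo-distrib-+ n _ _)

⊛-distribʳ : ∀ f g h → ((g ⊕ h) ⊛ f) ≐ ((g ⊛ f) ⊕ (h ⊛ f))
⊛-distribʳ f g h n = trans (sumTo-cong n λ k → ℤP.*-distribʳ-+ (f (n ∸ k)) (g k) (h k))
                           (sumTo-distrib-+ n _ _)

⊛-negˡ : ∀ f g → ((⊖ f) ⊛ g) ≐ (⊖ (f ⊛ g))
⊛-negˡ f g n = trans (sumTo-cong n λ k → sym (ℤP.neg-distribˡ-* (f k) (g (n ∸ k))))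
                     (sumTo-neg n _)

⊛-*ˡ : ∀ a f g n → ((λ k → a * f k) ⊛ g) n ≡ a * (f ⊛ g) n
⊛-*ˡ a f g n = trans (sumTo-cong n λ k → ℤP.*-assoc a (f k) (g (n ∸ k))) (sumTo-*ˡ n a _)

⊛-assoc : ∀ f g h → ((f ⊛ g) ⊛ h) ≐ (f ⊛ (g ⊛ h))
⊛-assoc f g h zero    = ℤP.*-assoc (f 0) (g 0) (h 0)
⊛-assoc f g h (suc n) = begin
  ((f ⊛ g) ⊛ h) (suc n)
    ≡⟨ ⊛-suc (f ⊛ g) h n ⟩
  f 0 * g 0 * h (suc n) + (tail (f ⊛ g) ⊛ h) n
    ≡⟨ cong (_+_ (f 0 * g 0 * h (suc n))) (trans (⊛-congʳ h (⊛-suc f g) n)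
                                              (⊛-distribʳ h (λ k → f 0 * tail g k) (tail f ⊛ g) n)) ⟩
  f 0 * g 0 * h (suc n) + (((λ k → f 0 * tail g k) ⊛ h) n + ((tail f ⊛ g) ⊛ h) n)
    ≡⟨ cong (_+_ (f 0 * g 0 * h (suc n))) (cong₂ _+_ (⊛-*ˡ (f 0) (tail g) h n) (⊛-assoc (tail f) g h n)) ⟩
  f 0 * g 0 * h (suc n) + (f 0 * (tail g ⊛ h) n + (tail f ⊛ (g ⊛ h)) n)
    ≡⟨ regroup (f 0) (g 0) (h (suc n)) _ _ ⟩
  f 0 * (g 0 * h (suc n) + (tail g ⊛ h) n) + (tail f ⊛ (g ⊛ h)) n
    ≡⟨ cong (λ i → f 0 * i + (tail f ⊛ (g ⊛ h)) n) (⊛-suc g h n) ⟨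
  f 0 * (g ⊛ h) (suc n) + (tail f ⊛ (g ⊛ h)) n
    ≡⟨ ⊛-suc f (g ⊛ h) n ⟨
  (f ⊛ (g ⊛ h)) (suc n) ∎
  where
  open ≡-Reasoning
  regroup : ∀ a b c x y → a * b * c + (a * x + y) ≡ a * (b * c + x) + y
  regroup = solve-∀

⊛-identityˡ : ∀ f → (𝟙 ⊛ f) ≐ f
⊛-identityˡ f zero    = ℤP.*-identityˡ (f 0)
⊛-identityˡ f (suc n) = trans (⊛-suc 𝟙 f n) (trans (cong₂ _+_ (ℤP.*-identityˡ (f (suc n))) (sumTo-zero n))
                              (ℤP.+-identityʳ (f (suc n))))

tail-𝕩 : tail 𝕩 ≐ 𝟙
tail-𝕩 zero    = refl
tail-𝕩 (suc n) = refl

𝕩⊛-suc : ∀ f n → (𝕩 ⊛ f) (suc n) ≡ f n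
𝕩⊛-suc f n = trans (⊛-suc 𝕩 f n)
  (trans (ℤP.+-identityˡ _) (trans (⊛-congʳ f tail-𝕩 n) (⊛-identityˡ f n)))

-1^n*-1^n≡1 : ∀ n → -1ℤ ^ n * -1ℤ ^ n ≡ 1ℤ
-1^n*-1^n≡1 zero    = refl
-1^n*-1^n≡1 (suc n) = trans (square-neg (-1ℤ ^ n)) (-1^n*-1^n≡1 n)
  where
  square-neg : ∀ i → -1ℤ * i * (-1ℤ * i) ≡ i * i
  square-neg = solve-∀

negArg-involutive : ∀ f → negArg (negArg f) ≐ f
negArg-involutive f n = begin
  -1ℤ ^ n * (-1ℤ ^ n * f n) ≡⟨ ℤP.*-assoc (-1ℤ ^ n) _ _ ⟨
  -1ℤ ^ n * -1ℤ ^ n * f n   ≡⟨ cong (_* f n) (-1^n*-1^n≡1 n) ⟩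
  1ℤ * f n                  ≡⟨ ℤP.*-identityˡ (f n) ⟩
  f n                       ∎
  where open ≡-Reasoning

negArg-⊛ : ∀ f g → negArg (f ⊛ g) ≐ (negArg f ⊛ negArg g)
negArg-⊛ f g n = trans (sym (sumTo-*ˡ n (-1ℤ ^ n) _)) (sumTo-cong≤ n term)
  where
  open ≡-Reasoning
  interchange* : ∀ a b x y → a * b * (x * y) ≡ a * x * (b * y)
  interchange* = solve-∀
  term : ∀ k → k ≤ n → -1ℤ ^ n * (f k * g (n ∸ k)) ≡ -1ℤ ^ k * f k * (-1ℤ ^ (n ∸ k) * g (n ∸ k))
  term k k≤n = begin
    -1ℤ ^ n * (f k * g (n ∸ k))
      ≡⟨ cong (λ j → -1ℤ ^ j * (f k * g (n ∸ k))) (ℕP.m+[n∸m]≡n k≤n) ⟨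
    -1ℤ ^ (k ℕ.+ (n ∸ k)) * (f k * g (n ∸ k))
      ≡⟨ cong (_* (f k * g (n ∸ k))) (ℤP.^-distribˡ-+-* -1ℤ k (n ∸ k)) ⟩
    -1ℤ ^ k * -1ℤ ^ (n ∸ k) * (f k * g (n ∸ k))
      ≡⟨ interchange* (-1ℤ ^ k) _ _ _ ⟩
    -1ℤ ^ k * f k * (-1ℤ ^ (n ∸ k) * g (n ∸ k)) ∎

sumTo-pos : ∀ n (f : ℕ → ℕ) → sumTo n (λ k → + f k) ≡ + ∑[ k < suc n ] f (toℕ k)
sumTo-pos zero    f = cong +_ (sym (ℕP.+-identityʳ (f 0)))
sumTo-pos (suc n) f = trans (sumTo-suc n (λ k → + f k))
  (trans (cong (_+_ (+ f 0)) (sumTo-pos n (f ∘ suc))) (sym (ℤP.pos-+ (f 0) _)))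

⊛-pos : ∀ (f g : ℕ → ℕ) n →
        ((+_ ∘ f) ⊛ (+_ ∘ g)) n ≡ + ∑[ k < suc n ] (f (toℕ k) ℕ.* g (n ∸ toℕ k))
⊛-pos f g n = trans (sumTo-cong n λ k → sym (ℤP.pos-* (f k) (g (n ∸ k))))
                    (sumTo-pos n λ k → f k ℕ.* g (n ∸ k))

⊕-cong : ∀ {f f′ g g′} → f ≐ f′ → g ≐ g′ → (f ⊕ g) ≐ (f′ ⊕ g′)
⊕-cong f≐f′ g≐g′ n = cong₂ _+_ (f≐f′ n) (g≐g′ n)

⊕-comm : ∀ f g → (f ⊕ g) ≐ (g ⊕ f)
⊕-comm f g n = ℤP.+-comm (f n) (g n)

⊛-left-comm : ∀ f g h → (f ⊛ (g ⊛ h)) ≐ (g ⊛ (f ⊛ h))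
⊛-left-comm f g h = begin
  f ⊛ (g ⊛ h)   ≈⟨ ⊛-assoc f g h ⟨
  (f ⊛ g) ⊛ h   ≈⟨ ⊛-congʳ h (⊛-comm f g) ⟩
  (g ⊛ f) ⊛ h   ≈⟨ ⊛-assoc g f h ⟩
  g ⊛ (f ⊛ h)   ∎
  where open ≐-Reasoning

⊛-inverse-step : ∀ {h g c} → (h ⊛ g) ≐ 𝟙 → c ≐ (g ⊕ (𝕩 ⊛ (g ⊛ c))) → (((⊖ 𝕩) ⊕ h) ⊛ c) ≐ 𝟙
⊛-inverse-step {h} {g} {c} h⊛g≐𝟙 c≐ = begin
  ((⊖ 𝕩) ⊕ h) ⊛ c               ≈⟨ ⊛-distribʳ c (⊖ 𝕩) h ⟩
  ((⊖ 𝕩) ⊛ c) ⊕ (h ⊛ c)         ≈⟨ ⊕-cong (⊛-negˡ 𝕩 c) h⊛c ⟩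
  (⊖ (𝕩 ⊛ c)) ⊕ (𝟙 ⊕ (𝕩 ⊛ c))   ≈⟨ (λ n → cancel ((𝕩 ⊛ c) n) (𝟙 n)) ⟩
  𝟙                             ∎
  where
  open ≐-Reasoning
  cancel : ∀ a y → - a + (y + a) ≡ y
  cancel = solve-∀
  h⊛[g⊛c] : (h ⊛ (g ⊛ c)) ≐ c
  h⊛[g⊛c] = begin
    h ⊛ (g ⊛ c)   ≈⟨ ⊛-assoc h g c ⟨
    (h ⊛ g) ⊛ c   ≈⟨ ⊛-congʳ c h⊛g≐𝟙 ⟩
    𝟙 ⊛ c         ≈⟨ ⊛-identityˡ c ⟩
    c             ∎
  h⊛c : (h ⊛ c) ≐ (𝟙 ⊕ (𝕩 ⊛ c))
  h⊛c = begin
    h ⊛ c                           ≈⟨ ⊛-congˡ h c≐ ⟩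
    h ⊛ (g ⊕ (𝕩 ⊛ (g ⊛ c)))         ≈⟨ ⊛-distribˡ h g (𝕩 ⊛ (g ⊛ c)) ⟩
    (h ⊛ g) ⊕ (h ⊛ (𝕩 ⊛ (g ⊛ c)))   ≈⟨ ⊕-cong h⊛g≐𝟙 (⊛-left-comm h 𝕩 (g ⊛ c)) ⟩
    𝟙 ⊕ (𝕩 ⊛ (h ⊛ (g ⊛ c)))         ≈⟨ ⊕-cong {𝟙} (λ _ → refl) (⊛-congˡ 𝕩 h⊛[g⊛c]) ⟩
    𝟙 ⊕ (𝕩 ⊛ c)                     ∎

negArg-𝟙 : negArg 𝟙 ≐ 𝟙
negArg-𝟙 zero    = refl
negArg-𝟙 (suc n) = ℤP.*-zeroʳ (-1ℤ ^ suc n)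

negArg-⊖𝕩 : negArg (⊖ 𝕩) ≐ 𝕩
negArg-⊖𝕩 zero          = refl
negArg-⊖𝕩 (suc zero)    = refl
negArg-⊖𝕩 (suc (suc n)) = ℤP.*-zeroʳ (-1ℤ ^ suc (suc n))

negArg-⊕ : ∀ f g → negArg (f ⊕ g) ≐ (negArg f ⊕ negArg g)
negArg-⊕ f g n = ℤP.*-distribˡ-+ (-1ℤ ^ n) (f n) (g n)

negArg-inverse : ∀ {f g} → (f ⊛ g) ≐ 𝟙 → (negArg g ⊛ negArg f) ≐ 𝟙
negArg-inverse {f} {g} f⊛g≐𝟙 n = begin
  (negArg g ⊛ negArg f) n   ≡⟨ ⊛-comm (negArg g) (negArg f) n ⟩
  (negArg f ⊛ negArg g) n   ≡⟨ negArg-⊛ f g n ⟨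
  -1ℤ ^ n * (f ⊛ g) n       ≡⟨ cong (-1ℤ ^ n *_) (f⊛g≐𝟙 n) ⟩
  -1ℤ ^ n * 𝟙 n             ≡⟨ negArg-𝟙 n ⟩
  𝟙 n                       ∎
  where open ≡-Reasoning

recipF : ℕ → FPS
recipF zero    = 𝟙 ⊕ (⊖ 𝕩)
recipF (suc m) = (⊖ 𝕩) ⊕ negArg (F m)

invNegF : ℕ → FPS
invNegF zero    = 𝟙 ⊕ 𝕩
invNegF (suc m) = 𝕩 ⊕ F m

invNegF≐negArg-recipF : ∀ m → invNegF m ≐ negArg (recipF m)
invNegF≐negArg-recipF zero    = ≐-sym (≐-trans (negArg-⊕ 𝟙 (⊖ 𝕩)) (⊕-cong negArg-𝟙 negArg-⊖𝕩))
invNegF≐negArg-recipF (suc m) =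
  ≐-sym (≐-trans (negArg-⊕ (⊖ 𝕩) (negArg (F m))) (⊕-cong negArg-⊖𝕩 (negArg-involutive (F m))))

invNegF-coeff : ∀ m → invNegF m ≐ (+_ ∘ Recurrence.p m)
invNegF-coeff zero    zero          = refl
invNegF-coeff zero    (suc zero)    = refl
invNegF-coeff zero    (suc (suc n)) = refl
invNegF-coeff (suc m) zero          = refl
invNegF-coeff (suc m) (suc n)       = begin
  𝕩 (suc n) + + b (suc n) m
    ≡⟨ ℤP.+-comm (𝕩 (suc n)) _ ⟩
  + b (suc n) m + 𝕩 (suc n)
    ≡⟨ cong₂ _+_ (cong +_ (b-suc n m)) (𝕩-diag n) ⟩
  + ∑[ i < suc m ] rowSumB (suc m) n (toℕ i) + + rowSumB (suc m) n (suc m)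
    ≡⟨ ℤP.pos-+ (∑[ i < suc m ] rowSumB (suc m) n (toℕ i)) (rowSumB (suc m) n (suc m)) ⟨
  + (∑[ i < suc m ] rowSumB (suc m) n (toℕ i) ℕ.+ rowSumB (suc m) n (suc m))
    ≡⟨ cong +_ (sum-toℕ-init-last (suc m) (rowSumB (suc m) n)) ⟨
  + Recurrence.q (suc m) n ∎
  where
  open ≡-Reasoning
  𝕩-diag : ∀ n → 𝕩 (suc n) ≡ + rowSumB (suc m) n (suc m)
  𝕩-diag zero    = refl
  𝕩-diag (suc n) = cong +_ (sym (rowSumB-≥ {suc m} n ℕP.≤-refl))

module _ (m : ℕ) where
  open Recurrence m using (c; p; c-suc; c-suc-sum)

  F-suc-coeff : F (suc m) ≐ (+_ ∘ c)
  F-suc-coeff zero    = refl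
  F-suc-coeff (suc n) = cong +_ (trans (b-suc n (suc m)) (sym (c-suc-sum n)))

  F-suc-recurrence : F (suc m) ≐ (invNegF m ⊕ (𝕩 ⊛ (invNegF m ⊛ F (suc m))))
  F-suc-recurrence zero    = sym (trans (ℤP.+-identityʳ _) (invNegF-coeff m 0))
  F-suc-recurrence (suc n) = begin
    F (suc m) (suc n)
      ≡⟨ F-suc-coeff (suc n) ⟩
    + c (suc n)
      ≡⟨ cong +_ (c-suc n) ⟩
    + (p (suc n) ℕ.+ ∑[ k < suc n ] (p (toℕ k) ℕ.* c (n ∸ toℕ k)))
      ≡⟨ ℤP.pos-+ (p (suc n)) _ ⟩
    + p (suc n) + + ∑[ k < suc n ] (p (toℕ k) ℕ.* c (n ∸ toℕ k))
      ≡⟨ cong₂ _+_ (invNegF-coeff m (suc n))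
                   (trans (⊛-cong (invNegF-coeff m) F-suc-coeff n) (⊛-pos p c n)) ⟨
    invNegF m (suc n) + (invNegF m ⊛ F (suc m)) n
      ≡⟨ cong (_+_ (invNegF m (suc n))) (𝕩⊛-suc (invNegF m ⊛ F (suc m)) n) ⟨
    invNegF m (suc n) + (𝕩 ⊛ (invNegF m ⊛ F (suc m))) (suc n) ∎
    where open ≡-Reasoning

recipF-inverse : ∀ m → (recipF m ⊛ F m) ≐ 𝟙
recipF-inverse zero    =
  ≐-trans (⊛-congʳ (F 0) (⊕-comm 𝟙 (⊖ 𝕩))) (⊛-inverse-step {𝟙} {𝟙} (⊛-identityˡ 𝟙) geometric)
  where
  geometric : F 0 ≐ (𝟙 ⊕ (𝕩 ⊛ (𝟙 ⊛ F 0)))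
  geometric zero    = refl
  geometric (suc n) = sym (trans (ℤP.+-identityˡ _) (trans (𝕩⊛-suc (𝟙 ⊛ F 0) n)
                                                         (trans (⊛-identityˡ (F 0) n) (cong +_ (b-zero n)))))
    where
    b-zero : ∀ n → b n 0 ≡ 1
    b-zero zero    = refl
    b-zero (suc n) = refl
recipF-inverse (suc m) = ⊛-inverse-step {g = invNegF m} negArg-F⊛invNegF (F-suc-recurrence m)
  where
  negArg-F⊛invNegF : (negArg (F m) ⊛ invNegF m) ≐ 𝟙
  negArg-F⊛invNegF = ≐-trans (⊛-congˡ (negArg (F m)) (invNegF≐negArg-recipF m))
                             (negArg-inverse {recipF m} (recipF-inverse m))

theorem7 : (((𝟙 ⊕ (⊖ 𝕩)) ⊛ F 0) ≐ 𝟙)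
    × ((m : ℕ) → (((⊖ 𝕩) ⊕ negArg (F m)) ⊛ F (suc m)) ≐ 𝟙)
theorem7 = recipF-inverse 0 , recipF-inverse ∘ suc
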